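{- Let $G$ and $H$ be finite simple graphs such that $H$ is vertex-transitive. If there exists a graph homomorphism $\sigma: G \to H$, then $$\frac{\Sigma(G)}{|V(G)|} \le \frac{\Sigma(H)}{|V(H)|}.$$
   Context: All graphs are finite, undirected, without loops or multiple edges. A proper coloring of a graph $G$ is a map $c: V(G)\to \{1,2,3,\dots\}$ such that adjacent vertices receive different colors. For a proper coloring $c$, $\Sigma_c(G)=\sum_{v\in V(G)} c(v)$, and the chromatic sum is $\Sigma(G)=\min\{\Sigma_c(G) : c \text{ a proper coloring of } G\}$. A homomorphism from $G$ to $H$ is a map $\sigma: V(G)\to V(H)$ such that $uv\in E(G)$ implies $\sigma(u)\sigma(v)\in E(H)$. $H$ is vertex-transitive if its automorphism group acts transitively on $V(H)$. -}

module Defs where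

open import Level using (0ℓ)
open import Data.Nat using (ℕ; suc; _+_; _*_; _≤_)
open import Data.Fin using (Fin)
open import Data.Fin.Properties using ()
open import Data.List using (map)
open import Data.Nat.ListAction using (sum)
open import Data.List using (allFin)
open import Data.Product using (Σ; _×_; ∃-syntax; _,_)
open import Relation.Nullary using (¬_)
open import Relation.Binary.PropositionalEquality using (_≡_; _≢_)
open import Function.Bundles using (_⤖_; Bijection)

record Graph (n : ℕ) : Set₁ where
  field
    Adj     : Fin n → Fin n → Set
    sym     : ∀ {u v} → Adj u v → Adj v u
    irrefl  : ∀ {u} → ¬ Adj u u
open Graph public

∣V∣ : ∀ {n} → Graph n → ℕ
∣V∣ {n} _ = n

record ProperColoring {n : ℕ} (G : Graph n) : Set where
  field
    col      : Fin n → ℕ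
    positive : ∀ v → 1 ≤ col v
    proper   : ∀ {u v} → Adj G u v → col u ≢ col v
open ProperColoring public

colorSum : ∀ {n} {G : Graph n} → ProperColoring G → ℕ
colorSum {n} c = sum (map (col c) (allFin n))

IsChromaticSum : ∀ {n} → Graph n → ℕ → Set
IsChromaticSum G s =
  (Σ (ProperColoring G) λ c → colorSum c ≡ s) ×
  (∀ (c : ProperColoring G) → s ≤ colorSum c)

Homomorphism : ∀ {n m} → Graph n → Graph m → Set
Homomorphism {n} {m} G H =
  Σ (Fin n → Fin m) λ σ → ∀ {u v} → Adj G u v → Adj H (σ u) (σ v)

IsAutomorphism : ∀ {n} → Graph n → (Fin n ⤖ Fin n) → Set
IsAutomorphism G f =
  ∀ u v → (Adj G u v → Adj G (to u) (to v)) × (Adj G (to u) (to v) → Adj G u v)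
  where open Bijection f using (to)

VertexTransitive : ∀ {n} → Graph n → Set
VertexTransitive {n} G =
  ∀ (u v : Fin n) → Σ (Fin n ⤖ Fin n) λ f →
    IsAutomorphism G f × (Bijection.to f u ≡ v)

-- Average over all endomorphisms φ of H. Each c ∘ φ ∘ σ is a proper colouring of G, so
-- Σ(G) · #End(H) ≤ ∑_φ ∑_x c(φ(σ x)). Composing with an automorphism moving z to z'
-- shows that the number of endomorphisms sending a fixed y to z does not depend on z,
-- so it is #End(H)/|V(H)|, and the right-hand side is #End(H) · |V(G)| · Σ(H)/|V(H)|.
-- Counting endomorphisms needs decidable adjacency in H; as the conclusion is a
-- decidable inequality, excluded middle for the finitely many edges is harmless.
module Submission where

open import Defs hiding (sym)
open import Data.Bool using (if_then_else_)
open import Data.Fin using (Fin; zero; suc)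
open import Data.Fin.Permutation using (Permutation′; _⟨$⟩ʳ_)
open import Data.Fin.Properties using (_≟_; all?)
open import Data.List using (tabulate)
open import Data.List.Properties using (map-tabulate)
open import Data.Nat using (ℕ; zero; suc; _+_; _*_; _≤_; _≤?_; z≤n; >-nonZero)
open import Data.Nat.ListAction using () renaming (sum to sumList)
open import Data.Nat.Properties hiding (_≟_)
open import Data.Nat.Tactic.RingSolver using (solve-∀)
open import Data.Product using (_×_; _,_; proj₁)
open import Data.Vec using (Vec; []; _∷_; lookup; allFin) renaming (map to mapVec)
open import Data.Vec.Properties using (lookup-map; lookup-allFin)
open import Function using (_∘_)
open import Function.Bundles using (Bijection)
open import Function.Properties.Bijection using (Bijection⇒Inverse)
open import Relation.Nullary using (¬_; Dec; yes; no; does; contradiction)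
open import Relation.Nullary.Decidable
  using (decidable-stable; ¬¬-excluded-middle; _×-dec_; _→-dec_)
open import Relation.Binary.PropositionalEquality
  using (_≡_; refl; cong; cong₂; sym; trans; subst; module ≡-Reasoning)
open import Algebra.Properties.Semiring.Sum +-*-semiring
  using (sum; sum-cong-≗; sum-remove; sum-replicate-zero; ∑-comm; ∑-permute;
         *-distribˡ-sum; *-distribʳ-sum)

𝟙 : ∀ {a} {A : Set a} → Dec A → ℕ
𝟙 a? = if does a? then 1 else 0

𝟙-× : ∀ {a b} {A : Set a} {B : Set b} (a? : Dec A) (b? : Dec B) →
      𝟙 (a? ×-dec b?) ≡ 𝟙 a? * 𝟙 b?
𝟙-× (yes _) (yes _) = refl
𝟙-× (yes _) (no _)  = refl
𝟙-× (no _)  _       = refl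

𝟙-mono : ∀ {a b} {A : Set a} {B : Set b} (a? : Dec A) (b? : Dec B) →
         (A → B) → 𝟙 a? ≤ 𝟙 b?
𝟙-mono (yes _) (yes _) _   = ≤-refl
𝟙-mono (yes a) (no ¬b) A→B = contradiction (A→B a) ¬b
𝟙-mono (no _)  _       _   = z≤n

1≤𝟙 : ∀ {a} {A : Set a} (a? : Dec A) → A → 1 ≤ 𝟙 a?
1≤𝟙 (yes _) _ = ≤-refl
1≤𝟙 (no ¬a) a = contradiction a ¬a

𝟙-*-monoʳ : ∀ {a} {A : Set a} (a? : Dec A) {x y : ℕ} → (A → x ≤ y) → 𝟙 a? * x ≤ 𝟙 a? * y
𝟙-*-monoʳ (yes a) x≤y = *-monoʳ-≤ 1 (x≤y a)
𝟙-*-monoʳ (no _)  _   = z≤n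

sum-mono-≤ : ∀ {k} {f g : Fin k → ℕ} → (∀ i → f i ≤ g i) → sum f ≤ sum g
sum-mono-≤ {zero}  _   = z≤n
sum-mono-≤ {suc k} f≤g = +-mono-≤ (f≤g zero) (sum-mono-≤ (f≤g ∘ suc))

sum-const : ∀ k (x : ℕ) → sum {k} (λ _ → x) ≡ k * x
sum-const zero    x = refl
sum-const (suc k) x = cong (x +_) (sum-const k x)

sum-≥ : ∀ {k} (f : Fin k → ℕ) i → f i ≤ sum f
sum-≥ {suc k} f i = ≤-trans (m≤m+n (f i) _) (≤-reflexive (sym (sum-remove {i = i} f)))

sum-δ : ∀ {k} (w : Fin k → ℕ) i → sum (λ j → 𝟙 (i ≟ j) * w j) ≡ w i
sum-δ {suc k} w zero =
  trans (cong₂ _+_ (*-identityˡ (w zero)) (sum-replicate-zero k)) (+-identityʳ (w zero))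
sum-δ {suc k} w (suc i) = sum-δ (w ∘ suc) i

sumList-tabulate : ∀ {k} (f : Fin k → ℕ) → sumList (tabulate f) ≡ sum f
sumList-tabulate {zero}  f = refl
sumList-tabulate {suc k} f = cong (f zero +_) (sumList-tabulate (f ∘ suc))

colorSum≡sum : ∀ {n} {G : Graph n} (c : ProperColoring G) → colorSum c ≡ sum (col c)
colorSum≡sum {n} c = trans (cong sumList (map-tabulate (λ i → i) (col c))) (sumList-tabulate (col c))

pullback : ∀ {n m} {G : Graph n} {H : Graph m} →
           Homomorphism G H → ProperColoring H → ProperColoring G
pullback (σ , hom) c = record
  { col      = col c ∘ σ
  ; positive = positive c ∘ σ
  ; proper   = λ uv → proper c (hom uv)
  }

¬¬-∀-Fin : ∀ {p k} {P : Fin k → Set p} → (∀ i → ¬ ¬ P i) → ¬ ¬ (∀ i → P i)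
¬¬-∀-Fin {k = zero}  _    ¬∀ = ¬∀ λ ()
¬¬-∀-Fin {k = suc k} ¬¬Pi ¬∀ =
  ¬¬Pi zero λ P0 → ¬¬-∀-Fin (¬¬Pi ∘ suc) λ P∘suc → ¬∀ λ { zero → P0 ; (suc i) → P∘suc i }

¬¬-Adj-decidable : ∀ {m} (H : Graph m) → ¬ ¬ (∀ u v → Dec (Adj H u v))
¬¬-Adj-decidable H = ¬¬-∀-Fin λ u → ¬¬-∀-Fin λ v → ¬¬-excluded-middle

module _ {m : ℕ} where

  ∑Vec : ∀ k → (Vec (Fin m) k → ℕ) → ℕ
  ∑Vec zero    F = F []
  ∑Vec (suc k) F = sum λ a → ∑Vec k (F ∘ (a ∷_))

  ∑Vec-cong : ∀ k {F G : Vec (Fin m) k → ℕ} → (∀ v → F v ≡ G v) → ∑Vec k F ≡ ∑Vec k G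
  ∑Vec-cong zero    F≡G = F≡G []
  ∑Vec-cong (suc k) F≡G = sum-cong-≗ λ a → ∑Vec-cong k (F≡G ∘ (a ∷_))

  ∑Vec-mono-≤ : ∀ k {F G : Vec (Fin m) k → ℕ} → (∀ v → F v ≤ G v) → ∑Vec k F ≤ ∑Vec k G
  ∑Vec-mono-≤ zero    F≤G = F≤G []
  ∑Vec-mono-≤ (suc k) F≤G = sum-mono-≤ λ a → ∑Vec-mono-≤ k (F≤G ∘ (a ∷_))

  ∑Vec-≥ : ∀ k (F : Vec (Fin m) k → ℕ) v → F v ≤ ∑Vec k F
  ∑Vec-≥ zero    F []      = ≤-refl
  ∑Vec-≥ (suc k) F (a ∷ v) =
    ≤-trans (∑Vec-≥ k (F ∘ (a ∷_)) v) (sum-≥ (λ b → ∑Vec k (F ∘ (b ∷_))) a)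

  ∑Vec-*ʳ : ∀ k (F : Vec (Fin m) k → ℕ) x → ∑Vec k (λ v → F v * x) ≡ ∑Vec k F * x
  ∑Vec-*ʳ zero    F x = refl
  ∑Vec-*ʳ (suc k) F x = trans (sum-cong-≗ λ a → ∑Vec-*ʳ k (F ∘ (a ∷_)) x)
                              (sym (*-distribʳ-sum x λ a → ∑Vec k (F ∘ (a ∷_))))

  ∑Vec-∑-comm : ∀ k {n} (F : Vec (Fin m) k → Fin n → ℕ) →
                ∑Vec k (λ v → sum (F v)) ≡ sum (λ i → ∑Vec k (λ v → F v i))
  ∑Vec-∑-comm zero    F = refl
  ∑Vec-∑-comm (suc k) F = trans (sum-cong-≗ λ a → ∑Vec-∑-comm k (F ∘ (a ∷_)))
                                (∑-comm λ a i → ∑Vec k (λ v → F (a ∷ v) i))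

  ∑Vec-permute : ∀ k (π : Permutation′ m) (F : Vec (Fin m) k → ℕ) →
                 ∑Vec k (F ∘ mapVec (π ⟨$⟩ʳ_)) ≡ ∑Vec k F
  ∑Vec-permute zero    π F = refl
  ∑Vec-permute (suc k) π F =
    trans (sum-cong-≗ λ a → ∑Vec-permute k π (F ∘ ((π ⟨$⟩ʳ a) ∷_)))
          (sym (∑-permute (λ b → ∑Vec k (F ∘ (b ∷_))) π))

module Endomorphisms {m} (H : Graph m) (adj? : ∀ u v → Dec (Adj H u v)) where

  IsEndo : Vec (Fin m) m → Set
  IsEndo φ = ∀ a b → Adj H a b → Adj H (lookup φ a) (lookup φ b)

  isEndo? : ∀ φ → Dec (IsEndo φ)
  isEndo? φ = all? λ a → all? λ b → adj? a b →-dec adj? (lookup φ a) (lookup φ b)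

  toHomomorphism : ∀ {φ} → IsEndo φ → Homomorphism H H
  toHomomorphism {φ} e = lookup φ , λ {a} {b} → e a b

  endoCount : ℕ
  endoCount = ∑Vec m (𝟙 ∘ isEndo?)

  sends? : ∀ y z φ → Dec (IsEndo φ × lookup φ y ≡ z)
  sends? y z φ = isEndo? φ ×-dec lookup φ y ≟ z

  fibre : Fin m → Fin m → ℕ
  fibre y z = ∑Vec m (𝟙 ∘ sends? y z)

  allFin-isEndo : IsEndo (allFin m)
  allFin-isEndo a b ab rewrite lookup-allFin a | lookup-allFin b = ab

  1≤endoCount : 1 ≤ endoCount
  1≤endoCount = ≤-trans (1≤𝟙 (isEndo? (allFin m)) allFin-isEndo) (∑Vec-≥ m (𝟙 ∘ isEndo?) (allFin m))

  ∑endo≡∑fibre : ∀ (w : Fin m → ℕ) y →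
    ∑Vec m (λ φ → 𝟙 (isEndo? φ) * w (lookup φ y)) ≡ sum (λ z → fibre y z * w z)
  ∑endo≡∑fibre w y = begin
    ∑Vec m (λ φ → 𝟙 (isEndo? φ) * w (lookup φ y))
      ≡⟨ ∑Vec-cong m split ⟩
    ∑Vec m (λ φ → sum λ z → 𝟙 (sends? y z φ) * w z)
      ≡⟨ ∑Vec-∑-comm m (λ φ z → 𝟙 (sends? y z φ) * w z) ⟩
    sum (λ z → ∑Vec m λ φ → 𝟙 (sends? y z φ) * w z)
      ≡⟨ sum-cong-≗ (λ z → ∑Vec-*ʳ m (𝟙 ∘ sends? y z) (w z)) ⟩
    sum (λ z → fibre y z * w z) ∎
    where
    open ≡-Reasoning
    split : ∀ φ → 𝟙 (isEndo? φ) * w (lookup φ y)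
                  ≡ sum λ z → 𝟙 (sends? y z φ) * w z
    split φ = begin
      𝟙 (isEndo? φ) * w (lookup φ y)
        ≡⟨ cong (𝟙 (isEndo? φ) *_) (sum-δ w (lookup φ y)) ⟨
      𝟙 (isEndo? φ) * sum (λ z → 𝟙 (lookup φ y ≟ z) * w z)
        ≡⟨ *-distribˡ-sum (𝟙 (isEndo? φ)) (λ z → 𝟙 (lookup φ y ≟ z) * w z) ⟩
      sum (λ z → 𝟙 (isEndo? φ) * (𝟙 (lookup φ y ≟ z) * w z))
        ≡⟨ sum-cong-≗ (λ z → trans (sym (*-assoc (𝟙 (isEndo? φ)) (𝟙 (lookup φ y ≟ z)) (w z)))
                                   (cong (_* w z) (sym (𝟙-× (isEndo? φ) (lookup φ y ≟ z))))) ⟩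
      sum (λ z → 𝟙 (sends? y z φ) * w z) ∎

  endoCount≡∑fibre : ∀ y → endoCount ≡ sum (fibre y)
  endoCount≡∑fibre y = begin
    endoCount                                  ≡⟨ ∑Vec-cong m (λ φ → sym (*-identityʳ _)) ⟩
    ∑Vec m (λ φ → 𝟙 (isEndo? φ) * 1)            ≡⟨ ∑endo≡∑fibre (λ _ → 1) y ⟩
    sum (λ z → fibre y z * 1)                  ≡⟨ sum-cong-≗ (λ z → *-identityʳ (fibre y z)) ⟩
    sum (fibre y)                              ∎
    where open ≡-Reasoning

  -- Post-composing with an automorphism g with g z ≡ z' is a bijection of tables.
  fibre-mono : VertexTransitive H → ∀ y z z' → fibre y z ≤ fibre y z'
  fibre-mono vt y z z' with vt z z'
  ... | g , g-aut , gz≡z' = begin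
    fibre y z                                ≤⟨ ∑Vec-mono-≤ m moved ⟩
    ∑Vec m (λ φ → 𝟙 (sends? y z' (g∘ φ)))    ≡⟨ ∑Vec-permute m (Bijection⇒Inverse g) _ ⟩
    fibre y z'                               ∎
    where
    open ≤-Reasoning
    open Bijection g using (to)

    g∘ : Vec (Fin m) m → Vec (Fin m) m
    g∘ = mapVec to

    moved : ∀ φ → 𝟙 (sends? y z φ) ≤ 𝟙 (sends? y z' (g∘ φ))
    moved φ = 𝟙-mono (sends? y z φ) (sends? y z' (g∘ φ)) λ (e , φy≡z) →
      g∘-isEndo e , trans (lookup-map y to φ) (trans (cong to φy≡z) gz≡z')
      where
      g∘-isEndo : IsEndo φ → IsEndo (g∘ φ)
      g∘-isEndo e a b ab rewrite lookup-map a to φ | lookup-map b to φ = proj₁ (g-aut _ _) (e a b ab)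

  m*fibre≤endoCount : VertexTransitive H → ∀ y z → m * fibre y z ≤ endoCount
  m*fibre≤endoCount vt y z = begin
    m * fibre y z               ≡⟨ sum-const m (fibre y z) ⟨
    sum {m} (λ _ → fibre y z)   ≤⟨ sum-mono-≤ (fibre-mono vt y z) ⟩
    sum (fibre y)               ≡⟨ endoCount≡∑fibre y ⟨
    endoCount                   ∎
    where open ≤-Reasoning

  endo-average : VertexTransitive H → ∀ (w : Fin m → ℕ) y →
    m * ∑Vec m (λ φ → 𝟙 (isEndo? φ) * w (lookup φ y)) ≤ endoCount * sum w
  endo-average vt w y = begin
    m * ∑Vec m (λ φ → 𝟙 (isEndo? φ) * w (lookup φ y))  ≡⟨ cong (m *_) (∑endo≡∑fibre w y) ⟩
    m * sum (λ z → fibre y z * w z)                     ≡⟨ *-distribˡ-sum m (λ z → fibre y z * w z) ⟩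
    sum (λ z → m * (fibre y z * w z))                   ≤⟨ sum-mono-≤ bound ⟩
    sum (λ z → endoCount * w z)                         ≡⟨ *-distribˡ-sum endoCount w ⟨
    endoCount * sum w                                   ∎
    where
    open ≤-Reasoning
    bound : ∀ z → m * (fibre y z * w z) ≤ endoCount * w z
    bound z = ≤-trans (≤-reflexive (sym (*-assoc m _ (w z))))
                      (*-monoˡ-≤ (w z) (m*fibre≤endoCount vt y z))

chromaticSum-bound : ∀ {n m} {G : Graph n} {H : Graph m} → (∀ u v → Dec (Adj H u v)) →
  VertexTransitive H → Homomorphism G H →
  ∀ s → (∀ (c : ProperColoring G) → s ≤ colorSum c) →
  (c : ProperColoring H) → s * m ≤ colorSum c * n
chromaticSum-bound {n} {m} {G} {H} adj? vt σ@(σ₀ , _) s minimal c =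
  *-cancelˡ-≤ endoCount {{>-nonZero 1≤endoCount}} (begin
    endoCount * (s * m)                       ≡⟨ reorder endoCount s m ⟩
    m * (endoCount * s)                       ≡⟨ cong (m *_) (∑Vec-*ʳ m (𝟙 ∘ isEndo?) s) ⟨
    m * ∑Vec m (λ φ → 𝟙 (isEndo? φ) * s)      ≤⟨ *-monoʳ-≤ m (∑Vec-mono-≤ m pullback-bound) ⟩
    m * ∑Vec m (λ φ → 𝟙 (isEndo? φ) * cost φ) ≡⟨ cong (m *_) cost-swap ⟩
    m * sum (λ x → ∑Vec m (weighted x))       ≡⟨ *-distribˡ-sum m (λ x → ∑Vec m (weighted x)) ⟩
    sum (λ x → m * ∑Vec m (weighted x))       ≤⟨ sum-mono-≤ (λ x → endo-average vt (col c) (σ₀ x)) ⟩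
    sum {n} (λ _ → endoCount * sum (col c))   ≡⟨ sum-const n _ ⟩
    n * (endoCount * sum (col c))             ≡⟨ reorder endoCount (sum (col c)) n ⟨
    endoCount * (sum (col c) * n)             ≡⟨ cong (λ t → endoCount * (t * n)) (colorSum≡sum c) ⟨
    endoCount * (colorSum c * n)              ∎)
  where
  open Endomorphisms H adj?
  open ≤-Reasoning

  reorder : ∀ a b k → a * (b * k) ≡ k * (a * b)
  reorder = solve-∀

  weighted : Fin n → Vec (Fin m) m → ℕ
  weighted x φ = 𝟙 (isEndo? φ) * col c (lookup φ (σ₀ x))

  cost : Vec (Fin m) m → ℕ
  cost φ = sum λ x → col c (lookup φ (σ₀ x))

  pullback-bound : ∀ φ → 𝟙 (isEndo? φ) * s ≤ 𝟙 (isEndo? φ) * cost φ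
  pullback-bound φ = 𝟙-*-monoʳ (isEndo? φ) λ e →
    let c∘φ∘σ = pullback {G = G} σ (pullback {G = H} (toHomomorphism {φ} e) c)
    in ≤-trans (minimal c∘φ∘σ) (≤-reflexive (colorSum≡sum c∘φ∘σ))

  cost-swap : ∑Vec m (λ φ → 𝟙 (isEndo? φ) * cost φ) ≡ sum (λ x → ∑Vec m (weighted x))
  cost-swap = trans (∑Vec-cong m λ φ → *-distribˡ-sum (𝟙 (isEndo? φ)) (λ x → col c (lookup φ (σ₀ x))))
                    (∑Vec-∑-comm m λ φ x → weighted x φ)

mainTheorem1 : ∀ {n m} (G : Graph n) (H : Graph m) →
    VertexTransitive H → Homomorphism G H →
    ∀ (s t : ℕ) → IsChromaticSum G s → IsChromaticSum H t →
    s * ∣V∣ H ≤ t * ∣V∣ G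
mainTheorem1 {n} {m} G H vt σ s t (_ , minimal) ((c , Σc≡t) , _) =
  decidable-stable (s * m ≤? t * n) λ ¬bound →
    ¬¬-Adj-decidable H λ adj? →
      ¬bound (subst (λ t → s * m ≤ t * n) Σc≡t (chromaticSum-bound adj? vt σ s minimal c))
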